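{- Let $\mathcal X$ be a set of $n\times n$ ASMs and $F(\mathcal X)$ the smallest face of $ASM_n$ containing $\mathcal X$. If $\mathcal G(F(\mathcal X))$ has a vertex of degree 3, then $|\mathcal X|>2$.
   Context: An $n\times n$ alternating sign matrix (ASM) is a matrix with entries in $\{0,1,-1\}$ whose rows and columns each sum to $1$ and in which the nonzero entries of each row and of each column alternate in sign. $ASM_n\subset\mathbb{R}^{n\times n}$ is the convex hull of all $n\times n$ ASMs; its vertices are exactly the $n\times n$ ASMs. Grid: internal vertices $(i,j)$, $1\le i,j\le n$ (row index $i$ increasing downward), and boundary vertices $(i,0),(i,n+1),(0,j),(n+1,j)$; grid edges join each internal $(i,j)$ to $(i,j\pm1)$ and $(i\pm1,j)$. The simple flow grid $g(A)$ of an ASM $A=(a_{ij})$ orients every grid edge exactly once: the edge between $(i,j)$ and $(i+1,j)$ is directed from $(i,j)$ to $(i+1,j)$ if $\sum_{i'\le i}a_{i'j}=1$ and the opposite way otherwise; the edge between $(i,j)$ and $(i,j+1)$ is directed from $(i,j)$ to $(i,j+1)$ if $\sum_{j'\le j}a_{ij'}=1$ and the opposite way otherwise. For a face $F$, the elementary flow grid $g(F)$ has as arc set the union of the arc sets of $g(A)$ over the vertices $A$ of $F$. A grid edge is doubly directed in $g(F)$ if both orientations occur. The doubly directed graph $\mathcal G(F)$ is the undirected graph whose edges are the doubly directed grid edges of $g(F)$ and whose vertices are the grid vertices incident to at least one such edge. -}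

module Defs where

open import Data.Nat using (ℕ; zero; suc)
open import Data.Fin using (Fin; toℕ)
open import Data.Integer as ℤ using (ℤ; 0ℤ; 1ℤ)
open import Data.Rational as ℚ using (ℚ)
open import Data.Vec as Vec using (Vec; lookup; toList; take)
open import Data.Vec.Functional as VF using ()
open import Data.List as List using (List; []; _∷_; foldr; filter; length)
open import Data.List.Membership.Propositional using (_∈_)
open import Data.List.Relation.Unary.All using (All)
open import Data.List.Relation.Unary.Any using (Any)
open import Data.List.Relation.Unary.Unique.Propositional using (Unique)
open import Data.Product using (Σ; ∃; _×_; _,_; proj₁; proj₂)
open import Data.Sum using (_⊎_)
open import Data.Unit using (⊤)
open import Relation.Nullary using (¬_; ¬?)
open import Relation.Binary.PropositionalEquality using (_≡_)

-- An n×n integer matrix; row i is  lookup A i  (0-based; paper row i+1).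
Matrix : ℕ → Set
Matrix n = Vec (Vec ℤ n) n

entry : ∀ {n} → Matrix n → Fin n → Fin n → ℤ
entry A i j = lookup (lookup A i) j

row : ∀ {n} → Matrix n → Fin n → List ℤ
row A i = toList (lookup A i)

col : ∀ {n} → Matrix n → Fin n → List ℤ
col A j = toList (Vec.map (λ r → lookup r j) A)

sumℤ : List ℤ → ℤ
sumℤ = foldr ℤ._+_ 0ℤ

nonzeros : List ℤ → List ℤ
nonzeros = filter (λ x → ¬? (x ℤ.≟ 0ℤ))

Alternating : List ℤ → Set
Alternating [] = ⊤
Alternating (x ∷ []) = ⊤
Alternating (x ∷ y ∷ r) = (x ℤ.* y ℤ.< 0ℤ) × Alternating (y ∷ r)

InSign : ℤ → Set
InSign x = (x ≡ 0ℤ) ⊎ ((x ≡ 1ℤ) ⊎ (x ≡ ℤ.-1ℤ))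

record IsASM {n : ℕ} (A : Matrix n) : Set where
  field
    entries  : ∀ i j → InSign (entry A i j)
    rowSum   : ∀ i → sumℤ (row A i) ≡ 1ℤ
    colSum   : ∀ j → sumℤ (col A j) ≡ 1ℤ
    rowAlt   : ∀ i → Alternating (nonzeros (row A i))
    colAlt   : ∀ j → Alternating (nonzeros (col A j))

sumℚ : List ℚ → ℚ
sumℚ = foldr ℚ._+_ ℚ.0ℚ

dot : ∀ {n} → (Fin n → Fin n → ℚ) → Matrix n → ℚ
dot {n} w A =
  sumℚ (List.map (λ i → sumℚ (List.map (λ j → w i j ℚ.* (entry A i j ℚ./ 1))
                                         (List.allFin n)))
                 (List.allFin n))

-- B attains the maximum of w over ASM_n (maximum over a polytope is
-- attained at / equals the maximum over its vertices, the ASMs)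
Maximizes : ∀ {n} → (Fin n → Fin n → ℚ) → Matrix n → Set
Maximizes {n} w B = ∀ (C : Matrix n) → IsASM C → dot w C ℚ.≤ dot w B

NonEmpty : {A : Set} → List A → Set
NonEmpty xs = Σ _ (λ x → x ∈ xs)

-- A is a vertex of the smallest face F(X) of ASM_n containing X:
-- F(X) is the intersection of all faces containing X.  The faces are
-- the empty face (contains X only if X is empty) and the exposed faces
-- {x ∈ ASM_n : ⟨w,x⟩ = max}; the vertices of a face are the ASMs in it.
FaceVertex : ∀ {n} → List (Matrix n) → Matrix n → Set
FaceVertex {n} X A =
  IsASM A × NonEmpty X ×
  (∀ (w : Fin n → Fin n → ℚ) → All (Maximizes w) X → Maximizes w A)

-- grid vertices are coordinate pairs (i , j), 0 ≤ i , j ≤ n+1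
GridVertex : Set
GridVertex = ℕ × ℕ

data Edge (n : ℕ) : Set where
  vert  : Fin (suc n) → Fin n → Edge n
  horiz : Fin n → Fin (suc n) → Edge n

endpoints : ∀ {n} → Edge n → GridVertex × GridVertex
endpoints (vert i j)  = (toℕ i , suc (toℕ j)) , (suc (toℕ i) , suc (toℕ j))
endpoints (horiz i j) = (suc (toℕ i) , toℕ j) , (suc (toℕ i) , suc (toℕ j))

Incident : ∀ {n} → GridVertex → Edge n → Set
Incident v e = (v ≡ proj₁ (endpoints e)) ⊎ (v ≡ proj₂ (endpoints e))

-- In g(A), edge e is directed "forward" (downward for vertical edges,
-- rightward for horizontal edges) iff the relevant partial sum is 1:
--   vert i j  : Σ_{i' ≤ i} a_{i' , j+1} = 1
--   horiz i j : Σ_{j' ≤ j} a_{i+1 , j'} = 1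
-- otherwise it is directed backward.
Forward : ∀ {n} → Matrix n → Edge n → Set
Forward A (vert i j)  = sumℤ (List.take (toℕ i) (col A j)) ≡ 1ℤ
Forward A (horiz i j) = sumℤ (List.take (toℕ j) (row A i)) ≡ 1ℤ

DoublyDirected : ∀ {n} → List (Matrix n) → Edge n → Set
DoublyDirected X e =
  ∃ λ A → ∃ λ B → FaceVertex X A × FaceVertex X B × Forward A e × ¬ Forward B e

HasDegree : ∀ {n} → (Edge n → Set) → GridVertex → ℕ → Set
HasDegree {n} P v d =
  ∃ λ (es : List (Edge n)) →
    Unique es × All (λ e → P e × Incident v e) es ×
    (∀ e → P e → Incident v e → e ∈ es) × (length es ≡ d)

-- For an edge e, the orientation of e in g(A) is read off a partial row or
-- column sum s_e(A), a linear functional taking only the values 0 and 1 on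
-- ASM_n.  If s_e is constant on X it is maximised (as s_e or as -s_e) by all
-- of X, hence constant on F(X); so a doubly directed edge needs two matrices
-- of X with different values of s_e.  For X = {A, B} the doubly directed
-- edges are those with s_e(A) + s_e(B) = 1.  Three distinct edges meeting at
-- a vertex force it to be internal, and at an internal vertex every matrix
-- satisfies s_south + s_west = s_north + s_east.  Hence if three of the four
-- edges there have s_e(A) + s_e(B) = 1, so has the fourth, and the vertex
-- has degree 4, not 3.
module Submission where

open import Data.Nat using (ℕ; _<_)
open import Data.List using (List; length)
open import Data.List.Relation.Unary.All using (All)
open import Data.List.Relation.Unary.Unique.Propositional using (Unique)
open import Data.Product using (∃)

open import Defs
open import Data.Nat using (zero; suc; _<ᵇ_; _≡ᵇ_; s≤s; z≤n)
import Data.Nat.Properties as ℕP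
open import Data.Bool using (Bool; true; false; not; if_then_else_)
open import Data.Fin as Fin using (Fin; toℕ; inject₁)
open import Data.Fin.Properties using (toℕ-injective; toℕ-inject₁; all?; any?)
  renaming (_≟_ to _≟ᶠ_)
open import Data.Integer as ℤ using (ℤ; 0ℤ; 1ℤ; -1ℤ; _+_; _*_; -_)
import Data.Integer.Properties as ℤP
open import Algebra.Properties.AbelianGroup ℤP.+-0-abelianGroup using (∙-cancelʳ)
open import Algebra.Properties.CommutativeSemigroup ℤP.+-commutativeSemigroup
  using (interchange)
open import Data.Rational as ℚ using (ℚ)
import Data.Rational.Properties as ℚP
open import Data.Rational.Unnormalised as ℚᵘ using (mkℚᵘ; *≡*; *≤*)
import Data.Rational.Unnormalised.Properties as ℚᵘP
open import Data.Vec as Vec using (Vec; lookup; toList)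
import Data.Vec.Properties as VecP
open import Data.List using ([]; _∷_; tabulate; take)
import Data.List as List
import Data.List.Properties as ListP
open import Data.List.Membership.Propositional using (_∈_; _∉_)
open import Data.List.Membership.Propositional.Properties using (∈-map⁻)
open import Data.List.Relation.Unary.All as All using ([]; _∷_)
open import Data.List.Relation.Unary.All.Properties using (tabulate⁺; ¬Any⇒All¬)
open import Data.List.Relation.Unary.Any as Any using (Any; here; there)
open import Data.List.Relation.Unary.AllPairs using ([]; _∷_)
open import Data.Product using (∃₂; _×_; _,_; proj₁; proj₂)
open import Data.Product.Properties using (,-injectiveˡ; ,-injectiveʳ)
open import Data.Sum using (_⊎_; inj₁; inj₂; [_,_]′)
open import Data.Empty using (⊥; ⊥-elim)
open import Data.Unit using (tt)
open import Function using (_∘_; id)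
open import Function.Bundles using (_⇔_; mk⇔; Equivalence)
open import Function.Definitions using (Injective)
open import Relation.Nullary using (¬_; ¬?)
open import Relation.Nullary.Decidable using (from-yes; decidable-stable; _→-dec_; _×-dec_)
open import Relation.Binary.PropositionalEquality
open import Data.List.Membership.DecPropositional (_≟ᶠ_ {4}) using (_∈?_)

-- This is how dot embeds the entries; ℚ._/_ normalises, so fromℤ does not
-- compute on variables and its laws are proved through ℚᵘ.
fromℤ : ℤ → ℚ
fromℤ x = x ℚ./ 1

toℚᵘ-fromℤ : ∀ x → ℚ.toℚᵘ (fromℤ x) ℚᵘ.≃ mkℚᵘ x 0
toℚᵘ-fromℤ x = ℚP.toℚᵘ-fromℚᵘ (mkℚᵘ x 0)

≡-via-ℚᵘ : ∀ {p q r} → ℚ.toℚᵘ p ℚᵘ.≃ r → ℚ.toℚᵘ q ℚᵘ.≃ r → p ≡ q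
≡-via-ℚᵘ p≃r q≃r = ℚP.toℚᵘ-injective (ℚᵘP.≃-trans p≃r (ℚᵘP.≃-sym q≃r))

fromℤ-+ : ∀ x y → fromℤ (x + y) ≡ fromℤ x ℚ.+ fromℤ y
fromℤ-+ x y = ≡-via-ℚᵘ (toℚᵘ-fromℤ (x + y)) sum≃
  where
  sum≃ : ℚ.toℚᵘ (fromℤ x ℚ.+ fromℤ y) ℚᵘ.≃ mkℚᵘ (x + y) 0
  sum≃ = ℚᵘP.≃-trans (ℚP.toℚᵘ-homo-+ (fromℤ x) (fromℤ y))
           (ℚᵘP.≃-trans (ℚᵘP.+-cong (toℚᵘ-fromℤ x) (toℚᵘ-fromℤ y))
             (*≡* (cong (_* 1ℤ) (cong₂ _+_ (ℤP.*-identityʳ x) (ℤP.*-identityʳ y)))))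

fromℤ-* : ∀ x y → fromℤ (x * y) ≡ fromℤ x ℚ.* fromℤ y
fromℤ-* x y = ≡-via-ℚᵘ (toℚᵘ-fromℤ (x * y)) product≃
  where
  product≃ : ℚ.toℚᵘ (fromℤ x ℚ.* fromℤ y) ℚᵘ.≃ mkℚᵘ (x * y) 0
  product≃ = ℚᵘP.≃-trans (ℚP.toℚᵘ-homo-* (fromℤ x) (fromℤ y))
               (ℚᵘP.*-cong (toℚᵘ-fromℤ x) (toℚᵘ-fromℤ y))

fromℤ-mono-≤ : ∀ {x y} → x ℤ.≤ y → fromℤ x ℚ.≤ fromℤ y
fromℤ-mono-≤ {x} {y} x≤y = ℚP.toℚᵘ-cancel-≤
  (ℚᵘP.≤-respˡ-≃ (ℚᵘP.≃-sym (toℚᵘ-fromℤ x)) (ℚᵘP.≤-respʳ-≃ (ℚᵘP.≃-sym (toℚᵘ-fromℤ y))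
    (*≤* (subst₂ ℤ._≤_ (sym (ℤP.*-identityʳ x)) (sym (ℤP.*-identityʳ y)) x≤y))))

fromℤ-cancel-≤ : ∀ {x y} → fromℤ x ℚ.≤ fromℤ y → x ℤ.≤ y
fromℤ-cancel-≤ {x} {y} le
  with *≤* x≤y ← ℚᵘP.≤-respˡ-≃ (toℚᵘ-fromℤ x) (ℚᵘP.≤-respʳ-≃ (toℚᵘ-fromℤ y) (ℚP.toℚᵘ-mono-≤ le))
  = subst₂ ℤ._≤_ (ℤP.*-identityʳ x) (ℤP.*-identityʳ y) x≤y

∑ : ∀ {m} → (Fin m → ℤ) → ℤ
∑ f = sumℤ (tabulate f)

prefix : ∀ {m} → ℕ → (Fin m → ℤ) → ℤ
prefix k f = sumℤ (take k (tabulate f))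

when : Bool → ℤ → ℤ
when b x = if b then x else 0ℤ

∑-cong : ∀ {m} {f g : Fin m → ℤ} → (∀ i → f i ≡ g i) → ∑ f ≡ ∑ g
∑-cong f≗g = cong sumℤ (ListP.tabulate-cong f≗g)

∑-zero : ∀ {m} → ∑ {m} (λ _ → 0ℤ) ≡ 0ℤ
∑-zero {zero} = refl
∑-zero {suc m} = cong (0ℤ +_) (∑-zero {m})

∑-neg : ∀ {m} (f : Fin m → ℤ) → ∑ (λ i → - f i) ≡ - ∑ f
∑-neg {zero} f = refl
∑-neg {suc m} f = trans (cong (- f Fin.zero +_) (∑-neg (f ∘ Fin.suc)))
                        (sym (ℤP.neg-distrib-+ (f Fin.zero) (∑ (f ∘ Fin.suc))))

∑-when : ∀ {m} b (f : Fin m → ℤ) → ∑ (λ i → when b (f i)) ≡ when b (∑ f)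
∑-when true f = refl
∑-when {m} false f = ∑-zero {m}

∑-indicator : ∀ {m} (f : Fin m → ℤ) k → ∑ (λ i → when (toℕ i ≡ᵇ toℕ k) (f i)) ≡ f k
∑-indicator {suc m} f Fin.zero =
  trans (cong (f Fin.zero +_) (∑-zero {m})) (ℤP.+-identityʳ (f Fin.zero))
∑-indicator {suc m} f (Fin.suc k) =
  trans (ℤP.+-identityˡ (∑ λ i → when (toℕ i ≡ᵇ toℕ k) (f (Fin.suc i)))) (∑-indicator (f ∘ Fin.suc) k)

∑-prefix : ∀ {m} (f : Fin m → ℤ) k → ∑ (λ i → when (toℕ i <ᵇ k) (f i)) ≡ prefix k f
∑-prefix {zero} f zero = refl
∑-prefix {zero} f (suc k) = refl
∑-prefix {suc m} f zero = ∑-zero {suc m}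
∑-prefix {suc m} f (suc k) = cong (f Fin.zero +_) (∑-prefix (f ∘ Fin.suc) k)

prefix-suc : ∀ {m} (f : Fin m → ℤ) i → prefix (suc (toℕ i)) f ≡ prefix (toℕ i) f + f i
prefix-suc f Fin.zero = trans (ℤP.+-identityʳ (f Fin.zero)) (sym (ℤP.+-identityˡ (f Fin.zero)))
prefix-suc f (Fin.suc i) = trans (cong (f Fin.zero +_) (prefix-suc (f ∘ Fin.suc) i))
                                 (sym (ℤP.+-assoc (f Fin.zero) _ _))

sumℚ-fromℤ : ∀ {m} (f : Fin m → ℤ) → sumℚ (tabulate (fromℤ ∘ f)) ≡ fromℤ (∑ f)
sumℚ-fromℤ {zero} f = refl
sumℚ-fromℤ {suc m} f = trans (cong (fromℤ (f Fin.zero) ℚ.+_) (sumℚ-fromℤ (f ∘ Fin.suc)))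
                             (sym (fromℤ-+ (f Fin.zero) (∑ (f ∘ Fin.suc))))

dotℤ : ∀ {n} → (Fin n → Fin n → ℤ) → Matrix n → ℤ
dotℤ c C = ∑ λ i → ∑ λ j → c i j * entry C i j

dot-fromℤ : ∀ {n} (c : Fin n → Fin n → ℤ) C → dot (λ i j → fromℤ (c i j)) C ≡ fromℤ (dotℤ c C)
dot-fromℤ {n} c C = begin
  sumℚ (List.map (λ i → sumℚ (List.map (term i) (List.allFin n))) (List.allFin n))
    ≡⟨ cong sumℚ (ListP.map-tabulate id λ i → sumℚ (List.map (term i) (List.allFin n))) ⟩
  sumℚ (tabulate (λ i → sumℚ (List.map (term i) (List.allFin n))))
    ≡⟨ cong sumℚ (ListP.tabulate-cong row≡) ⟩
  sumℚ (tabulate (λ i → fromℤ (∑ λ j → c i j * entry C i j)))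
    ≡⟨ sumℚ-fromℤ (λ i → ∑ λ j → c i j * entry C i j) ⟩
  fromℤ (dotℤ c C) ∎
  where
  open ≡-Reasoning

  term : Fin n → Fin n → ℚ
  term i j = fromℤ (c i j) ℚ.* fromℤ (entry C i j)
  row≡ : ∀ i → sumℚ (List.map (term i) (List.allFin n)) ≡ fromℤ (∑ λ j → c i j * entry C i j)
  row≡ i = trans (cong sumℚ (ListP.map-tabulate id (term i)))
             (trans (cong sumℚ (ListP.tabulate-cong λ j → sym (fromℤ-* (c i j) (entry C i j))))
               (sumℚ-fromℤ λ j → c i j * entry C i j))

dotℤ-neg : ∀ {n} (c : Fin n → Fin n → ℤ) C → dotℤ (λ i j → - c i j) C ≡ - dotℤ c C
dotℤ-neg c C = begin
  (∑ λ i → ∑ λ j → - c i j * entry C i j)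
    ≡⟨ ∑-cong (λ i → ∑-cong λ j → sym (ℤP.neg-distribˡ-* (c i j) (entry C i j))) ⟩
  (∑ λ i → ∑ λ j → - (c i j * entry C i j))
    ≡⟨ ∑-cong (λ i → ∑-neg λ j → c i j * entry C i j) ⟩
  (∑ λ i → - ∑ λ j → c i j * entry C i j)
    ≡⟨ ∑-neg (λ i → ∑ λ j → c i j * entry C i j) ⟩
  - dotℤ c C ∎
  where open ≡-Reasoning

when-1-* : ∀ b b′ x → when b (when b′ 1ℤ) * x ≡ when b (when b′ x)
when-1-* true true x = ℤP.*-identityˡ x
when-1-* true false x = refl
when-1-* false b′ x = refl

dotℤ-separable : ∀ {n} (p q : Fin n → Bool) C →
  dotℤ (λ i j → when (p i) (when (q j) 1ℤ)) C ≡ ∑ λ i → when (p i) (∑ λ j → when (q j) (entry C i j))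
dotℤ-separable p q C = ∑-cong λ i →
  trans (∑-cong λ j → when-1-* (p i) (q j) (entry C i j)) (∑-when (p i) λ j → when (q j) (entry C i j))

toList≡tabulate : ∀ {A : Set} {m} (xs : Vec A m) → toList xs ≡ tabulate (lookup xs)
toList≡tabulate Vec.[] = refl
toList≡tabulate (x Vec.∷ xs) = cong (x ∷_) (toList≡tabulate xs)

row≡tabulate : ∀ {n} (C : Matrix n) i → row C i ≡ tabulate (entry C i)
row≡tabulate C i = toList≡tabulate (lookup C i)

col≡tabulate : ∀ {n} (C : Matrix n) j → col C j ≡ tabulate (λ i → entry C i j)
col≡tabulate C j = trans (VecP.toList-map (λ r → lookup r j) C)
  (trans (cong (Data.List.map (λ r → lookup r j)) (toList≡tabulate C))
         (ListP.map-tabulate (lookup C) (λ r → lookup r j)))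

partialSum : ∀ {n} → Matrix n → Edge n → ℤ
partialSum C (vert k j) = sumℤ (take (toℕ k) (col C j))
partialSum C (horiz i k) = sumℤ (take (toℕ k) (row C i))

forward⇔ : ∀ {n} (e : Edge n) {C} → Forward C e ⇔ (partialSum C e ≡ 1ℤ)
forward⇔ (vert _ _) = mk⇔ id id
forward⇔ (horiz _ _) = mk⇔ id id

partialSum-vert : ∀ {n} (C : Matrix n) k j → partialSum C (vert k j) ≡ prefix (toℕ k) (λ i → entry C i j)
partialSum-vert C k j = cong (sumℤ ∘ take (toℕ k)) (col≡tabulate C j)

partialSum-horiz : ∀ {n} (C : Matrix n) i k → partialSum C (horiz i k) ≡ prefix (toℕ k) (entry C i)
partialSum-horiz C i k = cong (sumℤ ∘ take (toℕ k)) (row≡tabulate C i)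

weight : ∀ {n} → Edge n → Fin n → Fin n → ℤ
weight (vert k j₀) i j = when (toℕ i <ᵇ toℕ k) (when (toℕ j ≡ᵇ toℕ j₀) 1ℤ)
weight (horiz i₀ k) i j = when (toℕ i ≡ᵇ toℕ i₀) (when (toℕ j <ᵇ toℕ k) 1ℤ)

dotℤ-weight : ∀ {n} (e : Edge n) C → dotℤ (weight e) C ≡ partialSum C e
dotℤ-weight (vert k j₀) C = begin
  dotℤ (weight (vert k j₀)) C
    ≡⟨ dotℤ-separable _ _ C ⟩
  (∑ λ i → when (toℕ i <ᵇ toℕ k) (∑ λ j → when (toℕ j ≡ᵇ toℕ j₀) (entry C i j)))
    ≡⟨ ∑-cong (λ i → cong (when _) (∑-indicator (entry C i) j₀)) ⟩
  (∑ λ i → when (toℕ i <ᵇ toℕ k) (entry C i j₀))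
    ≡⟨ ∑-prefix _ (toℕ k) ⟩
  prefix (toℕ k) (λ i → entry C i j₀)
    ≡⟨ sym (partialSum-vert C k j₀) ⟩
  partialSum C (vert k j₀) ∎
  where open ≡-Reasoning
dotℤ-weight (horiz i₀ k) C = begin
  dotℤ (weight (horiz i₀ k)) C
    ≡⟨ dotℤ-separable _ _ C ⟩
  (∑ λ i → when (toℕ i ≡ᵇ toℕ i₀) (∑ λ j → when (toℕ j <ᵇ toℕ k) (entry C i j)))
    ≡⟨ ∑-indicator _ i₀ ⟩
  (∑ λ j → when (toℕ j <ᵇ toℕ k) (entry C i₀ j))
    ≡⟨ ∑-prefix _ (toℕ k) ⟩
  prefix (toℕ k) (entry C i₀)
    ≡⟨ sym (partialSum-horiz C i₀ k) ⟩
  partialSum C (horiz i₀ k) ∎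
  where open ≡-Reasoning

Bit : ℤ → Set
Bit x = x ≡ 0ℤ ⊎ x ≡ 1ℤ

⟦_⟧ : Bool → ℤ
⟦ true ⟧ = 1ℤ
⟦ false ⟧ = 0ℤ

lastSign : Bool → ℤ
lastSign true = 1ℤ
lastSign false = -1ℤ

⟦⟧+0-bit : ∀ h → Bit (⟦ h ⟧ + 0ℤ)
⟦⟧+0-bit true = inj₂ refl
⟦⟧+0-bit false = inj₁ refl

-- ⟦ h ⟧ is the sum of the entries already read and lastSign h the sign of
-- the last nonzero one among them (a virtual -1 before the first entry).
prefix-bits : ∀ h xs → All InSign xs → Alternating (lastSign h ∷ nonzeros xs) →
  ∀ k → Bit (⟦ h ⟧ + sumℤ (take k xs))
prefix-bits h xs _ _ zero = ⟦⟧+0-bit h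
prefix-bits h [] _ _ (suc k) = ⟦⟧+0-bit h
prefix-bits h (x ∷ xs) (inj₁ refl ∷ signs) alt (suc k) =
  subst Bit (cong (⟦ h ⟧ +_) (sym (ℤP.+-identityˡ (sumℤ (take k xs))))) (prefix-bits h xs signs alt k)
prefix-bits false (x ∷ xs) (inj₂ (inj₁ refl) ∷ signs) (_ , alt) (suc k) =
  subst Bit (sym (ℤP.+-identityˡ (1ℤ + sumℤ (take k xs)))) (prefix-bits true xs signs alt k)
prefix-bits true (x ∷ xs) (inj₂ (inj₁ refl) ∷ _) (ℤ.+<+ () , _) (suc k)
prefix-bits false (x ∷ xs) (inj₂ (inj₂ refl) ∷ _) (ℤ.+<+ () , _) (suc k)
prefix-bits true (x ∷ xs) (inj₂ (inj₂ refl) ∷ signs) (_ , alt) (suc k) =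
  subst Bit (ℤP.+-assoc 1ℤ -1ℤ (sumℤ (take k xs))) (prefix-bits false xs signs alt k)

alternating-start : ∀ xs → All InSign xs → Alternating (nonzeros xs) →
  ∃ λ h → Alternating (lastSign h ∷ nonzeros xs)
alternating-start [] _ _ = false , tt
alternating-start (x ∷ xs) (inj₁ refl ∷ signs) alt = alternating-start xs signs alt
alternating-start (x ∷ xs) (inj₂ (inj₁ refl) ∷ _) alt = false , ℤ.-<+ , alt
alternating-start (x ∷ xs) (inj₂ (inj₂ refl) ∷ _) alt = true , ℤ.-<+ , alt

prefix-bit : ∀ xs → All InSign xs → Alternating (nonzeros xs) → sumℤ xs ≡ 1ℤ →
  ∀ k → Bit (sumℤ (take k xs))
prefix-bit xs signs alt total k with alternating-start xs signs alt
... | false , alt′ = subst Bit (ℤP.+-identityˡ (sumℤ (take k xs))) (prefix-bits false xs signs alt′ k)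
... | true , alt′ =
  ⊥-elim (1+1-not-bit (subst (λ s → Bit (1ℤ + s)) sum-all (prefix-bits true xs signs alt′ (length xs))))
  where
  sum-all : sumℤ (take (length xs) xs) ≡ 1ℤ
  sum-all = trans (cong sumℤ (ListP.take-all (length xs) xs ℕP.≤-refl)) total
  1+1-not-bit : ¬ Bit (1ℤ + 1ℤ)
  1+1-not-bit (inj₁ ())
  1+1-not-bit (inj₂ ())

partialSum-bit : ∀ {n} {C : Matrix n} → IsASM C → ∀ e → Bit (partialSum C e)
partialSum-bit {C = C} asm (vert k j) =
  prefix-bit (col C j)
    (subst (All InSign) (sym (col≡tabulate C j)) (tabulate⁺ λ i → IsASM.entries asm i j))
    (IsASM.colAlt asm j) (IsASM.colSum asm j) (toℕ k)
partialSum-bit {C = C} asm (horiz i k) =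
  prefix-bit (row C i)
    (subst (All InSign) (sym (row≡tabulate C i)) (tabulate⁺ (IsASM.entries asm i)))
    (IsASM.rowAlt asm i) (IsASM.rowSum asm i) (toℕ k)

bit-other : ∀ {x} b → Bit x → x ≢ ⟦ b ⟧ → x ≡ ⟦ not b ⟧
bit-other true (inj₁ x≡0) _ = x≡0
bit-other true (inj₂ x≡1) x≢1 = ⊥-elim (x≢1 x≡1)
bit-other false (inj₁ x≡0) x≢0 = ⊥-elim (x≢0 x≡0)
bit-other false (inj₂ x≡1) _ = x≡1

⟦⟧-≢-not : ∀ b → ⟦ b ⟧ ≢ ⟦ not b ⟧
⟦⟧-≢-not true ()
⟦⟧-≢-not false ()

bit≤1 : ∀ {x} → Bit x → x ℤ.≤ 1ℤ
bit≤1 (inj₁ refl) = ℤ.+≤+ z≤n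
bit≤1 (inj₂ refl) = ℤP.≤-refl

-bit≤0 : ∀ {x} → Bit x → - x ℤ.≤ 0ℤ
-bit≤0 (inj₁ refl) = ℤP.≤-refl
-bit≤0 (inj₂ refl) = ℤ.-≤+

¬forward⇒0 : ∀ {n} {C : Matrix n} {e} → IsASM C → ¬ Forward C e → partialSum C e ≡ 0ℤ
¬forward⇒0 {e = e} asm ¬fwd with partialSum-bit asm e
... | inj₁ s≡0 = s≡0
... | inj₂ s≡1 = ⊥-elim (¬fwd (Equivalence.from (forward⇔ e) s≡1))

face-attains-maximum : ∀ {n} {X : List (Matrix n)} {C} (c : Fin n → Fin n → ℤ) {m} →
  (∀ D → IsASM D → dotℤ c D ℤ.≤ m) → All IsASM X → All (λ A → dotℤ c A ≡ m) X →
  FaceVertex X C → dotℤ c C ≡ m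
face-attains-maximum {C = C} c {m} bounded asms attained (asmC , (A , A∈X) , maximal) =
  ℤP.≤-antisym (bounded C asmC) (fromℤ-cancel-≤ m≤C)
  where
  w = λ i j → fromℤ (c i j)
  maximizes : ∀ A → dotℤ c A ≡ m → Maximizes w A
  maximizes A A≡m D asmD = subst₂ ℚ._≤_ (sym (dot-fromℤ c D))
    (trans (cong fromℤ (sym A≡m)) (sym (dot-fromℤ c A))) (fromℤ-mono-≤ (bounded D asmD))
  m≤C : fromℤ m ℚ.≤ fromℤ (dotℤ c C)
  m≤C = subst₂ ℚ._≤_ (trans (dot-fromℤ c A) (cong fromℤ (All.lookup attained A∈X))) (dot-fromℤ c C)
    (maximal w (All.map (λ {A} → maximizes A) attained) A (All.lookup asms A∈X))

dotℤ-negWeight : ∀ {n} (e : Edge n) C → dotℤ (λ i j → - weight e i j) C ≡ - partialSum C e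
dotℤ-negWeight e C = trans (dotℤ-neg (weight e) C) (cong -_ (dotℤ-weight e C))

partialSum-on-face : ∀ {n} {X : List (Matrix n)} {C} e b → All IsASM X →
  All (λ A → partialSum A e ≡ ⟦ b ⟧) X → FaceVertex X C → partialSum C e ≡ ⟦ b ⟧
partialSum-on-face {C = C} e true asms ones face =
  trans (sym (dotℤ-weight e C)) (face-attains-maximum (weight e)
    (λ D asmD → subst (ℤ._≤ 1ℤ) (sym (dotℤ-weight e D)) (bit≤1 (partialSum-bit asmD e)))
    asms (All.map (λ {A} → trans (dotℤ-weight e A)) ones) face)
partialSum-on-face {C = C} e false asms zeros face =
  ℤP.neg-injective (trans (sym (dotℤ-negWeight e C)) (face-attains-maximum (λ i j → - weight e i j)
    (λ D asmD → subst (ℤ._≤ 0ℤ) (sym (dotℤ-negWeight e D)) (-bit≤0 (partialSum-bit asmD e)))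
    asms (All.map (λ {A} A≡0 → trans (dotℤ-negWeight e A) (cong -_ A≡0)) zeros) face))

member-faceVertex : ∀ {n} {X : List (Matrix n)} {A} → All IsASM X → A ∈ X → FaceVertex X A
member-faceVertex asms A∈X = All.lookup asms A∈X , (_ , A∈X) , λ w maxima → All.lookup maxima A∈X

value-on-face-attained : ∀ {n} {X : List (Matrix n)} {C} e b → All IsASM X → FaceVertex X C →
  partialSum C e ≡ ⟦ b ⟧ → Any (λ A → partialSum A e ≡ ⟦ b ⟧) X
value-on-face-attained e b asms face C≡b =
  decidable-stable (Any.any? (λ A → partialSum A e ℤ.≟ ⟦ b ⟧) _) λ none →
    ⟦⟧-≢-not b (trans (sym C≡b) (partialSum-on-face e (not b) asms
      (All.zipWith (λ (asm , ≢b) → bit-other b (partialSum-bit asm e) ≢b) (asms , ¬Any⇒All¬ _ none))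
      face))

doublyDirected⇒values : ∀ {n} {X : List (Matrix n)} {e} → All IsASM X → DoublyDirected X e →
  Any (λ A → partialSum A e ≡ 1ℤ) X × Any (λ A → partialSum A e ≡ 0ℤ) X
doublyDirected⇒values {e = e} asms (C , D , faceC , faceD , fwdC , ¬fwdD) =
  value-on-face-attained e true asms faceC (Equivalence.to (forward⇔ e) fwdC) ,
  value-on-face-attained e false asms faceD (¬forward⇒0 (proj₁ faceD) ¬fwdD)

mixed⇒doublyDirected : ∀ {n} {X : List (Matrix n)} {A B e} → All IsASM X → A ∈ X → B ∈ X →
  partialSum A e ≡ 1ℤ → partialSum B e ≡ 0ℤ → DoublyDirected X e
mixed⇒doublyDirected {e = e} asms A∈X B∈X A≡1 B≡0 =
  _ , _ , member-faceVertex asms A∈X , member-faceVertex asms B∈X , Equivalence.from (forward⇔ e) A≡1 ,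
  λ fwd → ⟦⟧-≢-not false (trans (sym B≡0) (Equivalence.to (forward⇔ e) fwd))

doublyDirected⇒1<length : ∀ {n} {X : List (Matrix n)} {e} → All IsASM X → DoublyDirected X e →
  1 < length X
doublyDirected⇒1<length {X = _ ∷ _ ∷ _} _ _ = s≤s (s≤s z≤n)
doublyDirected⇒1<length {X = []} asms dd with () ← proj₁ (doublyDirected⇒values asms dd)
doublyDirected⇒1<length {X = _ ∷ []} asms dd with doublyDirected⇒values asms dd
... | here A≡1 , here A≡0 = ⊥-elim (⟦⟧-≢-not true (trans (sym A≡1) A≡0))

Side : Set
Side = Fin 4

pattern north = Fin.zero
pattern south = Fin.suc Fin.zero
pattern west  = Fin.suc (Fin.suc Fin.zero)
pattern east  = Fin.suc (Fin.suc (Fin.suc Fin.zero))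

internal : ∀ {n} → Fin n → Fin n → GridVertex
internal i j = suc (toℕ i) , suc (toℕ j)

edgeAt : ∀ {n} → Fin n → Fin n → Side → Edge n
edgeAt i j north = vert (inject₁ i) j
edgeAt i j south = vert (Fin.suc i) j
edgeAt i j west = horiz i (inject₁ j)
edgeAt i j east = horiz i (Fin.suc j)

suc-toℕ-injective : ∀ {m} {a b : Fin m} → suc (toℕ a) ≡ suc (toℕ b) → a ≡ b
suc-toℕ-injective = toℕ-injective ∘ ℕP.suc-injective

edgeAt-incident : ∀ {n} (i j : Fin n) t → Incident (internal i j) (edgeAt i j t)
edgeAt-incident i j north = inj₂ (cong (λ k → suc k , suc (toℕ j)) (sym (toℕ-inject₁ i)))
edgeAt-incident i j south = inj₁ refl
edgeAt-incident i j west = inj₂ (cong (λ k → suc (toℕ i) , suc k) (sym (toℕ-inject₁ j)))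
edgeAt-incident i j east = inj₁ refl

classify : ∀ {n} {i j : Fin n} e → Incident (internal i j) e → ∃ λ t → edgeAt i j t ≡ e
classify (vert a b) (inj₁ q) =
  south , cong₂ vert (toℕ-injective (,-injectiveˡ q)) (suc-toℕ-injective (,-injectiveʳ q))
classify {i = i} (vert a b) (inj₂ q) =
  north , cong₂ vert (toℕ-injective (trans (toℕ-inject₁ i) (ℕP.suc-injective (,-injectiveˡ q))))
                     (suc-toℕ-injective (,-injectiveʳ q))
classify (horiz a b) (inj₁ q) =
  east , cong₂ horiz (suc-toℕ-injective (,-injectiveˡ q)) (toℕ-injective (,-injectiveʳ q))
classify {j = j} (horiz a b) (inj₂ q) =
  west , cong₂ horiz (suc-toℕ-injective (,-injectiveˡ q))
                     (toℕ-injective (trans (toℕ-inject₁ j) (ℕP.suc-injective (,-injectiveʳ q))))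

offset : ∀ {n} → Edge n → ℕ
offset (vert a _) = toℕ a
offset (horiz _ b) = toℕ b

inject₁≢suc : ∀ {m} (i : Fin m) → toℕ (inject₁ i) ≢ suc (toℕ i)
inject₁≢suc i eq = ℕP.1+n≢n (trans (sym eq) (toℕ-inject₁ i))

edgeAt-injective : ∀ {n} (i j : Fin n) {s t} → edgeAt i j s ≡ edgeAt i j t → s ≡ t
edgeAt-injective i j {north} {north} _ = refl
edgeAt-injective i j {south} {south} _ = refl
edgeAt-injective i j {west} {west} _ = refl
edgeAt-injective i j {east} {east} _ = refl
edgeAt-injective i j {north} {south} eq = ⊥-elim (inject₁≢suc i (cong offset eq))
edgeAt-injective i j {south} {north} eq = ⊥-elim (inject₁≢suc i (cong offset (sym eq)))
edgeAt-injective i j {west} {east} eq = ⊥-elim (inject₁≢suc j (cong offset eq))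
edgeAt-injective i j {east} {west} eq = ⊥-elim (inject₁≢suc j (cong offset (sym eq)))
edgeAt-injective i j {north} {west} ()
edgeAt-injective i j {north} {east} ()
edgeAt-injective i j {south} {west} ()
edgeAt-injective i j {south} {east} ()
edgeAt-injective i j {west} {north} ()
edgeAt-injective i j {west} {south} ()
edgeAt-injective i j {east} {north} ()
edgeAt-injective i j {east} {south} ()

isVertical : ∀ {n} → Edge n → Bool
isVertical (vert _ _) = true
isVertical (horiz _ _) = false

atStart : ∀ {A B : Set} → A ⊎ B → Bool
atStart (inj₁ _) = true
atStart (inj₂ _) = false

incident-injective : ∀ {n} {v} (e e′ : Edge n) (p : Incident v e) (q : Incident v e′) →
  isVertical e ≡ isVertical e′ → atStart p ≡ atStart q → e ≡ e′
incident-injective (vert a b) (vert c d) (inj₁ refl) (inj₁ q) _ _ =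
  cong₂ vert (toℕ-injective (,-injectiveˡ q)) (suc-toℕ-injective (,-injectiveʳ q))
incident-injective (vert a b) (vert c d) (inj₂ refl) (inj₂ q) _ _ =
  cong₂ vert (suc-toℕ-injective (,-injectiveˡ q)) (suc-toℕ-injective (,-injectiveʳ q))
incident-injective (horiz a b) (horiz c d) (inj₁ refl) (inj₁ q) _ _ =
  cong₂ horiz (suc-toℕ-injective (,-injectiveˡ q)) (toℕ-injective (,-injectiveʳ q))
incident-injective (horiz a b) (horiz c d) (inj₂ refl) (inj₂ q) _ _ =
  cong₂ horiz (suc-toℕ-injective (,-injectiveˡ q)) (suc-toℕ-injective (,-injectiveʳ q))
incident-injective (vert _ _) (vert _ _) (inj₁ _) (inj₂ _) _ ()
incident-injective (vert _ _) (vert _ _) (inj₂ _) (inj₁ _) _ ()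
incident-injective (horiz _ _) (horiz _ _) (inj₁ _) (inj₂ _) _ ()
incident-injective (horiz _ _) (horiz _ _) (inj₂ _) (inj₁ _) _ ()
incident-injective (vert _ _) (horiz _ _) _ _ () _
incident-injective (horiz _ _) (vert _ _) _ _ () _

Bool-pigeonhole : ∀ (x y z : Bool) → x ≡ y ⊎ x ≡ z ⊎ y ≡ z
Bool-pigeonhole false false _ = inj₁ refl
Bool-pigeonhole true true _ = inj₁ refl
Bool-pigeonhole false true false = inj₂ (inj₁ refl)
Bool-pigeonhole true false true = inj₂ (inj₁ refl)
Bool-pigeonhole false true true = inj₂ (inj₂ refl)
Bool-pigeonhole true false false = inj₂ (inj₂ refl)

no-three-parallel : ∀ {n} {v} (e₁ e₂ e₃ : Edge n) → Incident v e₁ → Incident v e₂ → Incident v e₃ →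
  isVertical e₁ ≡ isVertical e₂ → isVertical e₁ ≡ isVertical e₃ → e₁ ≢ e₂ → e₁ ≢ e₃ → e₂ ≢ e₃ → ⊥
no-three-parallel e₁ e₂ e₃ p q r ∥₁₂ ∥₁₃ ≢₁₂ ≢₁₃ ≢₂₃
  with Bool-pigeonhole (atStart p) (atStart q) (atStart r)
... | inj₁ p~q = ≢₁₂ (incident-injective e₁ e₂ p q ∥₁₂ p~q)
... | inj₂ (inj₁ p~r) = ≢₁₃ (incident-injective e₁ e₃ p r ∥₁₃ p~r)
... | inj₂ (inj₂ q~r) = ≢₂₃ (incident-injective e₂ e₃ q r (trans (sym ∥₁₂) ∥₁₃) q~r)

crossing : ∀ {n} {v} a b c d → Incident v (vert {n} a b) → Incident v (horiz c d) → v ≡ internal c b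
crossing _ _ _ _ p q = cong₂ _,_ ([ cong proj₁ , cong proj₁ ]′ q) ([ cong proj₂ , cong proj₂ ]′ p)

three-incident⇒internal : ∀ {n} {v} {e₁ e₂ e₃ : Edge n} →
  Incident v e₁ → Incident v e₂ → Incident v e₃ → e₁ ≢ e₂ → e₁ ≢ e₃ → e₂ ≢ e₃ →
  ∃₂ λ (i j : Fin n) → v ≡ internal i j
three-incident⇒internal {e₁ = e₁@(vert _ _)} {e₂@(vert _ _)} {e₃@(vert _ _)} p q r ≢₁₂ ≢₁₃ ≢₂₃ =
  ⊥-elim (no-three-parallel e₁ e₂ e₃ p q r refl refl ≢₁₂ ≢₁₃ ≢₂₃)
three-incident⇒internal {e₁ = vert a b} {vert _ _} {horiz c d} p _ r _ _ _ =
  c , b , crossing a b c d p r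
three-incident⇒internal {e₁ = vert a b} {horiz c d} p q _ _ _ _ =
  c , b , crossing a b c d p q
three-incident⇒internal {e₁ = horiz c d} {vert a b} p q _ _ _ _ =
  c , b , crossing a b c d q p
three-incident⇒internal {e₁ = horiz c d} {horiz _ _} {vert a b} p _ r _ _ _ =
  c , b , crossing a b c d r p
three-incident⇒internal {e₁ = e₁@(horiz _ _)} {e₂@(horiz _ _)} {e₃@(horiz _ _)} p q r ≢₁₂ ≢₁₃ ≢₂₃ =
  ⊥-elim (no-three-parallel e₁ e₂ e₃ p q r refl refl ≢₁₂ ≢₁₃ ≢₂₃)

incident-resp : ∀ {n} {u w} (e : Edge n) → u ≡ w → Incident u e → Incident w e
incident-resp e u≡w = subst (λ x → Incident x e) u≡w

Conserved : (Side → ℤ) → Set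
Conserved f = f south + f west ≡ f north + f east

partialSum-south : ∀ {n} (C : Matrix n) i j →
  partialSum C (edgeAt i j south) ≡ partialSum C (edgeAt i j north) + entry C i j
partialSum-south C i j = begin
  partialSum C (vert (Fin.suc i) j)
    ≡⟨ partialSum-vert C (Fin.suc i) j ⟩
  prefix (suc (toℕ i)) column
    ≡⟨ prefix-suc column i ⟩
  prefix (toℕ i) column + entry C i j
    ≡⟨ cong (λ k → prefix k column + entry C i j) (sym (toℕ-inject₁ i)) ⟩
  prefix (toℕ (inject₁ i)) column + entry C i j
    ≡⟨ cong (_+ entry C i j) (sym (partialSum-vert C (inject₁ i) j)) ⟩
  partialSum C (vert (inject₁ i) j) + entry C i j ∎
  where
  open ≡-Reasoning
  column = λ r → entry C r j

partialSum-east : ∀ {n} (C : Matrix n) i j →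
  partialSum C (edgeAt i j east) ≡ partialSum C (edgeAt i j west) + entry C i j
partialSum-east C i j = begin
  partialSum C (horiz i (Fin.suc j))
    ≡⟨ partialSum-horiz C i (Fin.suc j) ⟩
  prefix (suc (toℕ j)) (entry C i)
    ≡⟨ prefix-suc (entry C i) j ⟩
  prefix (toℕ j) (entry C i) + entry C i j
    ≡⟨ cong (λ k → prefix k (entry C i) + entry C i j) (sym (toℕ-inject₁ j)) ⟩
  prefix (toℕ (inject₁ j)) (entry C i) + entry C i j
    ≡⟨ cong (_+ entry C i j) (sym (partialSum-horiz C i (inject₁ j))) ⟩
  partialSum C (horiz i (inject₁ j)) + entry C i j ∎
  where open ≡-Reasoning

partialSum-conserved : ∀ {n} (C : Matrix n) i j → Conserved (λ t → partialSum C (edgeAt i j t))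
partialSum-conserved C i j = begin
  s south + s west                ≡⟨ cong (_+ s west) (partialSum-south C i j) ⟩
  (s north + entry C i j) + s west ≡⟨ ℤP.+-assoc (s north) _ _ ⟩
  s north + (entry C i j + s west) ≡⟨ cong (s north +_) (ℤP.+-comm (entry C i j) _) ⟩
  s north + (s west + entry C i j) ≡⟨ cong (s north +_) (sym (partialSum-east C i j)) ⟩
  s north + s east ∎
  where
  open ≡-Reasoning
  s = λ t → partialSum C (edgeAt i j t)

conserved-+ : ∀ {f g} → Conserved f → Conserved g → Conserved (λ t → f t + g t)
conserved-+ {f} {g} cf cg = trans (interchange (f south) (g south) (f west) (g west))
  (trans (cong₂ _+_ cf cg) (interchange (f north) (f east) (g north) (g east)))

unit-of-sum : ∀ {a b c d} → b + c ≡ a + d → b ≡ 1ℤ → c ≡ 1ℤ → d ≡ 1ℤ → a ≡ 1ℤ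
unit-of-sum {a} eq refl refl refl = sym (∙-cancelʳ 1ℤ 1ℤ a eq)

conserved-unit-closed : ∀ {f} → Conserved f → ∀ t → (∀ s → s ≢ t → f s ≡ 1ℤ) → f t ≡ 1ℤ
conserved-unit-closed c north u =
  unit-of-sum c (u south λ ()) (u west λ ()) (u east λ ())
conserved-unit-closed {f} c east u =
  unit-of-sum (trans c (ℤP.+-comm (f north) (f east))) (u south λ ()) (u west λ ()) (u north λ ())
conserved-unit-closed c south u =
  unit-of-sum (sym c) (u north λ ()) (u east λ ()) (u west λ ())
conserved-unit-closed {f} c west u =
  unit-of-sum (trans (sym c) (ℤP.+-comm (f south) (f west))) (u north λ ()) (u east λ ()) (u south λ ())

∈-map-injective⁻ : ∀ {A B : Set} {f : A → B} → Injective _≡_ _≡_ f →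
  ∀ {x} xs → f x ∈ List.map f xs → x ∈ xs
∈-map-injective⁻ {f = f} f-inj xs fx∈ with _ , y∈ , fx≡fy ← ∈-map⁻ f fx∈ =
  subst (_∈ xs) (sym (f-inj fx≡fy)) y∈

-- opaque, so that uses of the lemma never unfold the decision procedure
opaque
  complement-of-three : ∀ (s₁ s₂ s₃ : Side) → s₁ ≢ s₂ → s₁ ≢ s₃ → s₂ ≢ s₃ →
    ∃ λ t → t ∉ s₁ ∷ s₂ ∷ s₃ ∷ [] × (∀ s → s ≢ t → s ∈ s₁ ∷ s₂ ∷ s₃ ∷ [])
  complement-of-three = from-yes (all? λ s₁ → all? λ s₂ → all? λ s₃ →
    ¬? (s₁ ≟ᶠ s₂) →-dec ¬? (s₁ ≟ᶠ s₃) →-dec ¬? (s₂ ≟ᶠ s₃) →-dec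
    any? λ t → ¬? (t ∈? s₁ ∷ s₂ ∷ s₃ ∷ []) ×-dec
               all? λ s → ¬? (s ≟ᶠ t) →-dec s ∈? s₁ ∷ s₂ ∷ s₃ ∷ [])

no-three-of-four : (P : Side → Set) → (∀ t → (∀ s → s ≢ t → P s) → P t) →
  ∀ {s₁ s₂ s₃} → s₁ ≢ s₂ → s₁ ≢ s₃ → s₂ ≢ s₃ → All P (s₁ ∷ s₂ ∷ s₃ ∷ []) →
  (∀ s → P s → s ∈ s₁ ∷ s₂ ∷ s₃ ∷ []) → ⊥
no-three-of-four P closed ≢₁₂ ≢₁₃ ≢₂₃ holds complete
  with t , t∉ , others ← complement-of-three _ _ _ ≢₁₂ ≢₁₃ ≢₂₃
  = t∉ (complete t (closed t λ s s≢t → All.lookup holds (others s s≢t)))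

unit-flow-no-degree-three : ∀ {n} (D : Edge n → Set) (σ : Edge n → ℤ) →
  (∀ i j → Conserved (λ t → σ (edgeAt i j t))) →
  (∀ {e} → D e → σ e ≡ 1ℤ) → (∀ {e} → σ e ≡ 1ℤ → D e) → ∀ {v} → ¬ HasDegree D v 3
unit-flow-no-degree-three D σ conserved D⇒1 1⇒D
  ( e₁ ∷ e₂ ∷ e₃ ∷ [] , (≢₁₂ ∷ ≢₁₃ ∷ []) ∷ (≢₂₃ ∷ []) ∷ [] ∷ []
  , (D₁ , p₁) ∷ (D₂ , p₂) ∷ (D₃ , p₃) ∷ [] , complete , refl )
  with i , j , v≡ij ← three-incident⇒internal p₁ p₂ p₃ ≢₁₂ ≢₁₃ ≢₂₃
  with t₁ , refl ← classify e₁ (incident-resp e₁ v≡ij p₁)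
     | t₂ , refl ← classify e₂ (incident-resp e₂ v≡ij p₂)
     | t₃ , refl ← classify e₃ (incident-resp e₃ v≡ij p₃)
  = no-three-of-four (λ t → σ (edgeAt i j t) ≡ 1ℤ) (conserved-unit-closed (conserved i j))
      (≢₁₂ ∘ cong (edgeAt i j)) (≢₁₃ ∘ cong (edgeAt i j)) (≢₂₃ ∘ cong (edgeAt i j))
      (D⇒1 D₁ ∷ D⇒1 D₂ ∷ D⇒1 D₃ ∷ [])
      λ s σ≡1 → ∈-map-injective⁻ (edgeAt-injective i j) (t₁ ∷ t₂ ∷ t₃ ∷ [])
                  (complete (edgeAt i j s) (1⇒D σ≡1)
                     (incident-resp (edgeAt i j s) (sym v≡ij) (edgeAt-incident i j s)))

module _ {n} {A B : Matrix n} (asmA : IsASM A) (asmB : IsASM B) where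

  σ : Edge n → ℤ
  σ e = partialSum A e + partialSum B e

  doublyDirected⇒σ≡1 : ∀ {e} → DoublyDirected (A ∷ B ∷ []) e → σ e ≡ 1ℤ
  doublyDirected⇒σ≡1 dd with doublyDirected⇒values (asmA ∷ asmB ∷ []) dd
  ... | here A≡1 , there (here B≡0) = cong₂ _+_ A≡1 B≡0
  ... | there (here B≡1) , here A≡0 = cong₂ _+_ A≡0 B≡1
  ... | here A≡1 , here A≡0 = ⊥-elim (⟦⟧-≢-not true (trans (sym A≡1) A≡0))
  ... | there (here B≡1) , there (here B≡0) = ⊥-elim (⟦⟧-≢-not true (trans (sym B≡1) B≡0))

  σ≡1⇒doublyDirected : ∀ {e} → σ e ≡ 1ℤ → DoublyDirected (A ∷ B ∷ []) e
  σ≡1⇒doublyDirected {e} σ≡1 with partialSum-bit asmA e | partialSum-bit asmB e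
  ... | inj₁ A≡0 | inj₂ B≡1 =
    mixed⇒doublyDirected (asmA ∷ asmB ∷ []) (there (here refl)) (here refl) B≡1 A≡0
  ... | inj₂ A≡1 | inj₁ B≡0 =
    mixed⇒doublyDirected (asmA ∷ asmB ∷ []) (here refl) (there (here refl)) A≡1 B≡0
  ... | inj₁ A≡0 | inj₁ B≡0 with () ← trans (sym (cong₂ _+_ A≡0 B≡0)) σ≡1
  ... | inj₂ A≡1 | inj₂ B≡1 with () ← trans (sym (cong₂ _+_ A≡1 B≡1)) σ≡1

  σ-conserved : ∀ i j → Conserved (λ t → σ (edgeAt i j t))
  σ-conserved i j =
    conserved-+ {λ t → partialSum A (edgeAt i j t)} {λ t → partialSum B (edgeAt i j t)}
      (partialSum-conserved A i j) (partialSum-conserved B i j)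

  pair-no-degree-three : ∀ {v} → ¬ HasDegree (DoublyDirected (A ∷ B ∷ [])) v 3
  pair-no-degree-three = unit-flow-no-degree-three (DoublyDirected (A ∷ B ∷ [])) σ σ-conserved
    doublyDirected⇒σ≡1 σ≡1⇒doublyDirected

degree-three⇒edge : ∀ {n} {P : Edge n → Set} {v} → HasDegree P v 3 → ∃ P
degree-three⇒edge (_ ∷ _ , _ , (Pe , _) ∷ _ , _ , _) = _ , Pe

mainTheorem18 : (n : ℕ) (X : List (Matrix n)) → All IsASM X → Unique X →
    (∃ λ v → HasDegree (DoublyDirected X) v 3) → 2 < length X
mainTheorem18 n (_ ∷ _ ∷ _ ∷ _) _ _ _ = s≤s (s≤s (s≤s z≤n))
mainTheorem18 n (_ ∷ _ ∷ []) (asmA ∷ asmB ∷ []) _ (v , degree) =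
  ⊥-elim (pair-no-degree-three asmA asmB {v} degree)
mainTheorem18 n X@[] asms _ (v , degree)
  with e , dd ← degree-three⇒edge {P = DoublyDirected X} {v} degree
  with () ← doublyDirected⇒1<length {e = e} asms dd
mainTheorem18 n X@(_ ∷ []) asms _ (v , degree)
  with e , dd ← degree-three⇒edge {P = DoublyDirected X} {v} degree
  with s≤s () ← doublyDirected⇒1<length {e = e} asms dd
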